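{- For every integer $n>3$, the open ladder $OL_n$ satisfies $\chi_g(OL_n)=5$.
   Context: All graphs are finite, simple and connected. A graceful $k$-coloring of a non-empty graph $G$ ($k\geq 2$) is a proper vertex coloring $f:V(G)\to\{1,2,\dots,k\}$ such that the induced edge coloring $f^*(uv)=|f(u)-f(v)|$, with values in $\{1,\dots,k-1\}$, is a proper edge coloring. The graceful chromatic number $\chi_g(G)$ is the minimum such $k$. The closed ladder $L_n$ has vertex set $\{x_i,y_i:1\leq i\leq n\}$ and edge set $\{x_ix_{i+1},y_iy_{i+1}:1\leq i\leq n-1\}\cup\{x_iy_i:1\leq i\leq n\}$. The open ladder $OL_n$ ($n\geq 2$) is obtained from $L_n$ by removing the edges $x_1y_1$ and $x_ny_n$. -}

module Defs where

open import Data.Nat using (ℕ; zero; suc; _≤_; _<_; ∣_-_∣)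
open import Data.Fin using (Fin; toℕ)
open import Data.Bool using (Bool; not)
open import Data.Product using (_×_; _,_; Σ; ∃)
open import Relation.Binary.PropositionalEquality using (_≡_; _≢_)
open import Relation.Nullary using (¬_)

record Graph : Set₁ where
  field
    V   : Set
    Adj : V → V → Set
open Graph public

-- A graceful k-coloring: f : V → {1,…,k}, proper vertex coloring, and the
-- induced edge coloring uv ↦ |f u − f v| is a proper edge coloring, i.e.
-- two distinct edges uv, uw sharing the vertex u get different colors.
record IsGracefulColoring (G : Graph) (k : ℕ) (f : V G → ℕ) : Set where
  field
    inRange    : ∀ v → 1 ≤ f v × f v ≤ k
    properV    : ∀ {u v} → Adj G u v → f u ≢ f v
    properE    : ∀ {u v w} → Adj G u v → Adj G u w → v ≢ w →
                 ∣ f u - f v ∣ ≢ ∣ f u - f w ∣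

HasGracefulColoring : Graph → ℕ → Set
HasGracefulColoring G k = Σ (V G → ℕ) (IsGracefulColoring G k)

GracefulChromaticNumberIs : Graph → ℕ → Set
GracefulChromaticNumberIs G k =
  HasGracefulColoring G k × (∀ j → j < k → ¬ HasGracefulColoring G j)

-- Vertex (i , false) is x_{i+1}, (i , true) is y_{i+1}
-- (0-based index i : Fin n).  Edges: x_i x_{i+1}, y_i y_{i+1} (both
-- orientations) and rungs x_i y_i for 2 ≤ i ≤ n-1 (1-based), i.e.
-- 0 < toℕ i and toℕ i + 1 < n.
data OLAdj (n : ℕ) : Fin n × Bool → Fin n × Bool → Set where
  stepUp   : ∀ {i j : Fin n} (b : Bool) → suc (toℕ i) ≡ toℕ j → OLAdj n (i , b) (j , b)
  stepDown : ∀ {i j : Fin n} (b : Bool) → toℕ i ≡ suc (toℕ j) → OLAdj n (i , b) (j , b)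
  rung     : ∀ {i : Fin n} (b : Bool) → 0 < toℕ i → suc (toℕ i) < n →
             OLAdj n (i , b) (i , not b)

OL : ℕ → Graph
OL n = record { V = Fin n × Bool ; Adj = OLAdj n }

-- Upper bound: colour the rails periodically with period 4, the x-rail 1,4,2,5 and the
-- y-rail 2,5,1,4.  Every rung then has gap 1, every rail edge a gap of at least 2, and
-- consecutive rail gaps differ, which is all a graceful colouring needs.
-- Lower bound: with colours in {1,…,4}, a middle colour 2 or 3 has only the gaps 1 and 2
-- to the other colours, so every vertex of degree 3 is coloured 1 or 4.  In OL_n with
-- n ≥ 4 the vertex x₂ and its neighbours x₃, y₂ all have degree 3; both neighbours must
-- take the end colour not used by x₂, so the two edges at x₂ get the same gap.
module Submission where

open import Defs
open import Data.Nat using (ℕ; _>_; _+_; suc; _≤_; z≤n; s≤s; ∣_-_∣)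
open import Data.Nat.Properties
  using (≤-pred; ≤-trans; <⇒≤; <⇒≢; suc-injective; ∣-∣-comm; m≡n⇒∣m-n∣≡0)
open import Data.Fin using (Fin; toℕ) renaming (zero to fzero; suc to fsuc)
open import Data.Fin.Properties using (toℕ-injective)
open import Data.Bool using (Bool; true; false; not)
open import Data.Product using (_×_; _,_)
open import Data.Sum using (_⊎_; inj₁; inj₂)
open import Data.Empty using (⊥; ⊥-elim)
open import Relation.Binary.PropositionalEquality using (_≡_; _≢_; refl; sym; trans; cong; subst; ≢-sym)
open import Relation.Nullary using (¬_)

ColourIn : ℕ → ℕ → Set
ColourIn k x = 1 ≤ x × x ≤ k

ladderColour : ℕ → Bool → ℕ
ladderColour 0 false = 1
ladderColour 0 true  = 2
ladderColour 1 false = 4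
ladderColour 1 true  = 5
ladderColour 2 false = 2
ladderColour 2 true  = 1
ladderColour 3 false = 5
ladderColour 3 true  = 4
ladderColour (suc (suc (suc (suc i)))) b = ladderColour i b

ladderColour-in-range : ∀ i b → ColourIn 5 (ladderColour i b)
ladderColour-in-range 0 false = s≤s z≤n , s≤s z≤n
ladderColour-in-range 0 true  = s≤s z≤n , s≤s (s≤s z≤n)
ladderColour-in-range 1 false = s≤s z≤n , s≤s (s≤s (s≤s (s≤s z≤n)))
ladderColour-in-range 1 true  = s≤s z≤n , s≤s (s≤s (s≤s (s≤s (s≤s z≤n))))
ladderColour-in-range 2 false = s≤s z≤n , s≤s (s≤s z≤n)
ladderColour-in-range 2 true  = s≤s z≤n , s≤s z≤n
ladderColour-in-range 3 false = s≤s z≤n , s≤s (s≤s (s≤s (s≤s (s≤s z≤n))))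
ladderColour-in-range 3 true  = s≤s z≤n , s≤s (s≤s (s≤s (s≤s z≤n)))
ladderColour-in-range (suc (suc (suc (suc i)))) b = ladderColour-in-range i b

rung-gap≡1 : ∀ i b → ∣ ladderColour i b - ladderColour i (not b) ∣ ≡ 1
rung-gap≡1 0 false = refl
rung-gap≡1 0 true  = refl
rung-gap≡1 1 false = refl
rung-gap≡1 1 true  = refl
rung-gap≡1 2 false = refl
rung-gap≡1 2 true  = refl
rung-gap≡1 3 false = refl
rung-gap≡1 3 true  = refl
rung-gap≡1 (suc (suc (suc (suc i)))) b = rung-gap≡1 i b

rail-gap≥2 : ∀ i b → 2 ≤ ∣ ladderColour i b - ladderColour (suc i) b ∣
rail-gap≥2 0 false = s≤s (s≤s z≤n)
rail-gap≥2 0 true  = s≤s (s≤s z≤n)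
rail-gap≥2 1 false = s≤s (s≤s z≤n)
rail-gap≥2 1 true  = s≤s (s≤s z≤n)
rail-gap≥2 2 false = s≤s (s≤s z≤n)
rail-gap≥2 2 true  = s≤s (s≤s z≤n)
rail-gap≥2 3 false = s≤s (s≤s z≤n)
rail-gap≥2 3 true  = s≤s (s≤s z≤n)
rail-gap≥2 (suc (suc (suc (suc i)))) b = rail-gap≥2 i b

consecutive-rail-gaps-differ : ∀ i b →
  ∣ ladderColour (suc i) b - ladderColour i b ∣ ≢
  ∣ ladderColour (suc i) b - ladderColour (suc (suc i)) b ∣
consecutive-rail-gaps-differ 0 false = λ ()
consecutive-rail-gaps-differ 0 true  = λ ()
consecutive-rail-gaps-differ 1 false = λ ()
consecutive-rail-gaps-differ 1 true  = λ ()
consecutive-rail-gaps-differ 2 false = λ ()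
consecutive-rail-gaps-differ 2 true  = λ ()
consecutive-rail-gaps-differ 3 false = λ ()
consecutive-rail-gaps-differ 3 true  = λ ()
consecutive-rail-gaps-differ (suc (suc (suc (suc i)))) b = consecutive-rail-gaps-differ i b

module LadderColouring (n : ℕ) where

  colouring : V (OL n) → ℕ
  colouring (i , b) = ladderColour (toℕ i) b

  gap : V (OL n) → V (OL n) → ℕ
  gap u v = ∣ colouring u - colouring v ∣

  up-gap≥2 : ∀ {i j : Fin n} (b : Bool) → suc (toℕ i) ≡ toℕ j → 2 ≤ gap (i , b) (j , b)
  up-gap≥2 {i} b i+1≡j rewrite sym i+1≡j = rail-gap≥2 (toℕ i) b

  down-gap≥2 : ∀ {i j : Fin n} (b : Bool) → toℕ i ≡ suc (toℕ j) → 2 ≤ gap (i , b) (j , b)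
  down-gap≥2 {j = j} b i≡j+1 rewrite i≡j+1 =
    subst (2 ≤_) (∣-∣-comm (ladderColour (toℕ j) b) _) (rail-gap≥2 (toℕ j) b)

  edge-gap≥1 : ∀ {u v} → OLAdj n u v → 1 ≤ gap u v
  edge-gap≥1 (stepUp b e)   = <⇒≤ (up-gap≥2 b e)
  edge-gap≥1 (stepDown b e) = <⇒≤ (down-gap≥2 b e)
  edge-gap≥1 (rung {i} b _ _) rewrite rung-gap≡1 (toℕ i) b = s≤s z≤n

  rail-gap≢rung-gap : ∀ {x y} → 2 ≤ x → y ≡ 1 → x ≢ y
  rail-gap≢rung-gap 2≤x refl = ≢-sym (<⇒≢ 2≤x)

  gaps-at-ends-of-rail-differ : ∀ {i j k : Fin n} (b : Bool) →
    suc (toℕ i) ≡ toℕ j → toℕ i ≡ suc (toℕ k) → gap (i , b) (k , b) ≢ gap (i , b) (j , b)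
  gaps-at-ends-of-rail-differ {k = k} b i+1≡j i≡k+1 rewrite sym i+1≡j | i≡k+1 =
    consecutive-rail-gaps-differ (toℕ k) b

  same-rail-vertex : ∀ {i j : Fin n} (b : Bool) → toℕ i ≡ toℕ j → (i , b) ≡ (j , b)
  same-rail-vertex b i≡j = cong (λ k → k , b) (toℕ-injective i≡j)

  properV : ∀ {u v} → OLAdj n u v → colouring u ≢ colouring v
  properV u~v fu≡fv = <⇒≢ (edge-gap≥1 u~v) (sym (m≡n⇒∣m-n∣≡0 fu≡fv))

  properE : ∀ {u v w} → OLAdj n u v → OLAdj n u w → v ≢ w → gap u v ≢ gap u w
  properE (stepUp b e) (stepUp _ e′) v≢w _ = v≢w (same-rail-vertex b (trans (sym e) e′))
  properE (stepUp b e) (stepDown _ e′) _ = ≢-sym (gaps-at-ends-of-rail-differ b e e′)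
  properE (stepUp b e) (rung {i} _ _ _) _ = rail-gap≢rung-gap (up-gap≥2 b e) (rung-gap≡1 (toℕ i) b)
  properE (stepDown b e) (stepUp _ e′) _ = gaps-at-ends-of-rail-differ b e′ e
  properE (stepDown b e) (stepDown _ e′) v≢w _ =
    v≢w (same-rail-vertex b (suc-injective (trans (sym e) e′)))
  properE (stepDown b e) (rung {i} _ _ _) _ = rail-gap≢rung-gap (down-gap≥2 b e) (rung-gap≡1 (toℕ i) b)
  properE (rung {i} b _ _) (stepUp _ e) _ =
    ≢-sym (rail-gap≢rung-gap (up-gap≥2 b e) (rung-gap≡1 (toℕ i) b))
  properE (rung {i} b _ _) (stepDown _ e) _ =
    ≢-sym (rail-gap≢rung-gap (down-gap≥2 b e) (rung-gap≡1 (toℕ i) b))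
  properE (rung _ _ _) (rung _ _ _) v≢w _ = v≢w refl

  isGraceful : IsGracefulColoring (OL n) 5 colouring
  isGraceful = record
    { inRange = λ { (i , b) → ladderColour-in-range (toℕ i) b }
    ; properV = properV
    ; properE = properE
    }

Extreme : ℕ → Set
Extreme x = x ≡ 1 ⊎ x ≡ 4

middle-colour-gap∈[1,2] : ∀ a b → 2 ≤ a → a ≤ 3 → ColourIn 4 b → a ≢ b →
                          ∣ a - b ∣ ≡ 1 ⊎ ∣ a - b ∣ ≡ 2
middle-colour-gap∈[1,2] 2 1 _ _ _ _ = inj₁ refl
middle-colour-gap∈[1,2] 2 2 _ _ _ a≢b = ⊥-elim (a≢b refl)
middle-colour-gap∈[1,2] 2 3 _ _ _ _ = inj₁ refl
middle-colour-gap∈[1,2] 2 4 _ _ _ _ = inj₂ refl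
middle-colour-gap∈[1,2] 3 1 _ _ _ _ = inj₂ refl
middle-colour-gap∈[1,2] 3 2 _ _ _ _ = inj₁ refl
middle-colour-gap∈[1,2] 3 3 _ _ _ a≢b = ⊥-elim (a≢b refl)
middle-colour-gap∈[1,2] 3 4 _ _ _ _ = inj₁ refl
middle-colour-gap∈[1,2] 0 _ () _ _ _
middle-colour-gap∈[1,2] 1 _ (s≤s ()) _ _ _
middle-colour-gap∈[1,2] (suc (suc (suc (suc _)))) _ _ (s≤s (s≤s (s≤s ()))) _ _
middle-colour-gap∈[1,2] _ 0 _ _ (() , _) _
middle-colour-gap∈[1,2] _ (suc (suc (suc (suc (suc _))))) _ _ (_ , s≤s (s≤s (s≤s (s≤s ())))) _

no-three-distinct-in-[1,2] : ∀ {x y z} → x ≡ 1 ⊎ x ≡ 2 → y ≡ 1 ⊎ y ≡ 2 → z ≡ 1 ⊎ z ≡ 2 →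
                             x ≢ y → x ≢ z → y ≢ z → ⊥
no-three-distinct-in-[1,2] (inj₁ refl) (inj₁ refl) _ x≢y _ _ = x≢y refl
no-three-distinct-in-[1,2] (inj₂ refl) (inj₂ refl) _ x≢y _ _ = x≢y refl
no-three-distinct-in-[1,2] (inj₁ refl) (inj₂ refl) (inj₁ refl) _ x≢z _ = x≢z refl
no-three-distinct-in-[1,2] (inj₁ refl) (inj₂ refl) (inj₂ refl) _ _ y≢z = y≢z refl
no-three-distinct-in-[1,2] (inj₂ refl) (inj₁ refl) (inj₁ refl) _ _ y≢z = y≢z refl
no-three-distinct-in-[1,2] (inj₂ refl) (inj₁ refl) (inj₂ refl) _ x≢z _ = x≢z refl

extreme-or-middle : ∀ {a} → ColourIn 4 a → Extreme a ⊎ (2 ≤ a × a ≤ 3)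
extreme-or-middle {1} _ = inj₁ (inj₁ refl)
extreme-or-middle {2} _ = inj₂ (s≤s (s≤s z≤n) , s≤s (s≤s z≤n))
extreme-or-middle {3} _ = inj₂ (s≤s (s≤s z≤n) , s≤s (s≤s (s≤s z≤n)))
extreme-or-middle {4} _ = inj₁ (inj₂ refl)
extreme-or-middle {0} (() , _)
extreme-or-middle {suc (suc (suc (suc (suc _))))} (_ , s≤s (s≤s (s≤s (s≤s ()))))

three-distinct-gaps⇒extreme : ∀ {a b c d} → ColourIn 4 a → ColourIn 4 b → ColourIn 4 c → ColourIn 4 d →
  a ≢ b → a ≢ c → a ≢ d →
  ∣ a - b ∣ ≢ ∣ a - c ∣ → ∣ a - b ∣ ≢ ∣ a - d ∣ → ∣ a - c ∣ ≢ ∣ a - d ∣ → Extreme a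
three-distinct-gaps⇒extreme {a} {b} {c} {d} a∈ b∈ c∈ d∈ a≢b a≢c a≢d b≢c b≢d c≢d
  with extreme-or-middle a∈
... | inj₁ extreme = extreme
... | inj₂ (2≤a , a≤3) = ⊥-elim (no-three-distinct-in-[1,2]
        (middle-colour-gap∈[1,2] a b 2≤a a≤3 b∈ a≢b)
        (middle-colour-gap∈[1,2] a c 2≤a a≤3 c∈ a≢c)
        (middle-colour-gap∈[1,2] a d 2≤a a≤3 d∈ a≢d) b≢c b≢d c≢d)

extreme-gaps-coincide : ∀ {a b c} → Extreme a → Extreme b → Extreme c → a ≢ b → a ≢ c →
                        ∣ a - b ∣ ≡ ∣ a - c ∣
extreme-gaps-coincide (inj₁ refl) (inj₁ refl) _ a≢b _ = ⊥-elim (a≢b refl)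
extreme-gaps-coincide (inj₂ refl) (inj₂ refl) _ a≢b _ = ⊥-elim (a≢b refl)
extreme-gaps-coincide (inj₁ refl) (inj₂ refl) (inj₁ refl) _ a≢c = ⊥-elim (a≢c refl)
extreme-gaps-coincide (inj₁ refl) (inj₂ refl) (inj₂ refl) _ _ = refl
extreme-gaps-coincide (inj₂ refl) (inj₁ refl) (inj₁ refl) _ _ = refl
extreme-gaps-coincide (inj₂ refl) (inj₁ refl) (inj₂ refl) _ a≢c = ⊥-elim (a≢c refl)

module _ {G : Graph} {k : ℕ} {f : V G → ℕ} (graceful : IsGracefulColoring G k f) where
  open IsGracefulColoring graceful

  degree-three⇒extreme : k ≤ 4 → ∀ {u v w z} → Adj G u v → Adj G u w → Adj G u z →
                         v ≢ w → v ≢ z → w ≢ z → Extreme (f u)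
  degree-three⇒extreme k≤4 {u} {v} {w} {z} u~v u~w u~z v≢w v≢z w≢z =
    three-distinct-gaps⇒extreme (colourIn4 u) (colourIn4 v) (colourIn4 w) (colourIn4 z)
      (properV u~v) (properV u~w) (properV u~z)
      (properE u~v u~w v≢w) (properE u~v u~z v≢z) (properE u~w u~z w≢z)
    where
    colourIn4 : ∀ x → ColourIn 4 (f x)
    colourIn4 x with inRange x
    ... | 1≤fx , fx≤k = 1≤fx , ≤-trans fx≤k k≤4

  extreme-neighbourhood-impossible : ∀ {u v w} → Adj G u v → Adj G u w → v ≢ w →
                                     Extreme (f u) → Extreme (f v) → Extreme (f w) → ⊥
  extreme-neighbourhood-impossible u~v u~w v≢w fu fv fw =
    properE u~v u~w v≢w (extreme-gaps-coincide fu fv fw (properV u~v) (properV u~w))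

OL-not-4-graceful : ∀ m {k} → k ≤ 4 → ¬ HasGracefulColoring (OL (4 + m)) k
OL-not-4-graceful m k≤4 (f , graceful) =
  extreme-neighbourhood-impossible graceful x₂~x₃ x₂~y₂ (λ ()) x₂-extreme x₃-extreme y₂-extreme
  where
  x₂ x₃ y₂ : V (OL (4 + m))
  x₂ = fsuc fzero , false
  x₃ = fsuc (fsuc fzero) , false
  y₂ = fsuc fzero , true
  x₂~x₃ : OLAdj (4 + m) x₂ x₃
  x₂~x₃ = stepUp false refl
  x₂~y₂ : OLAdj (4 + m) x₂ y₂
  x₂~y₂ = rung false (s≤s z≤n) (s≤s (s≤s (s≤s z≤n)))
  x₂-extreme : Extreme (f x₂)
  x₂-extreme = degree-three⇒extreme graceful k≤4
    (stepDown false refl) x₂~x₃ x₂~y₂ (λ ()) (λ ()) (λ ())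
  x₃-extreme : Extreme (f x₃)
  x₃-extreme = degree-three⇒extreme graceful k≤4
    (stepDown false refl) (stepUp false refl) (rung false (s≤s z≤n) (s≤s (s≤s (s≤s (s≤s z≤n)))))
    (λ ()) (λ ()) (λ ())
  y₂-extreme : Extreme (f y₂)
  y₂-extreme = degree-three⇒extreme graceful k≤4
    (stepDown true refl) (stepUp true refl) (rung true (s≤s z≤n) (s≤s (s≤s (s≤s z≤n))))
    (λ ()) (λ ()) (λ ())

corollary3p3 : (n : ℕ) → n > 3 → GracefulChromaticNumberIs (OL n) 5
corollary3p3 n@(suc (suc (suc (suc m)))) (s≤s (s≤s (s≤s (s≤s _)))) =
  (colouring , isGraceful) , λ j j<5 → OL-not-4-graceful m (≤-pred j<5)
  where open LadderColouring n
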